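{- Let $b\ge2$, $s\ge1$ and $u\ge0$ be integers and let $\mathbf{e}=(e_1,\dots,e_s)\in\mathbb{N}^s$. Let $h$ be the greatest common divisor of $e_1,\dots,e_s$. Then any $(u,\mathbf{e},s)$-sequence in base $b$ is a $(\lceil u/h\rceil,\mathbf{e}/h,s)$-sequence in base $b^h$, where $\mathbf{e}/h=(e_1/h,\dots,e_s/h)$.
   Context: $\mathbb{N}$ denotes the positive integers, $\lambda_s$ Lebesgue measure. An elementary interval in base $b$ is $J=\prod_{i=1}^s[a_ib^{ -d_i},(a_i+1)b^{ -d_i})$ with integers $d_i\ge0$, $0\le a_i<b^{d_i}$. For integers $0\le u\le m$ and $\mathbf{e}=(e_1,\dots,e_s)\in\mathbb{N}^s$, a set of $b^m$ points in $[0,1)^s$ is a $(u,m,\mathbf{e},s)$-net in base $b$ if every elementary interval $J$ in base $b$ with $\lambda_s(J)\ge b^{u-m}$ and $e_i\mid d_i$ for all $i$ contains exactly $b^m\lambda_s(J)$ of the points. For $\mathbf{x}\in[0,1]^s$, $[\mathbf{x}]_{b,m}$ denotes the coordinatewise $m$-digit truncation of $\mathbf{x}$ in base $b$. For an integer $u\ge0$, a sequence $\mathbf{x}_0,\mathbf{x}_1,\dots$ in $[0,1]^s$ is a $(u,\mathbf{e},s)$-sequence in base $b$ if for all integers $k\ge0$ and $m>u$ the points $[\mathbf{x}_n]_{b,m}$ with $kb^m\le n<(k+1)b^m$ form a $(u,m,\mathbf{e},s)$-net in base $b$. -}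

module Defs where

open import Data.Nat using (ℕ; zero; suc; _+_; _*_; _∸_; _^_; _≤_; _<_; _≤ᵇ_; _<ᵇ_)
open import Data.Nat.Divisibility using (_∣_)
open import Data.Nat.GCD using (gcd)
open import Data.Fin using (Fin; toℕ)
open import Data.Bool using (Bool; _∧_)
open import Data.List using (List; length; filterᵇ; upTo; tabulate; allFin; foldr)
open import Data.Nat.ListAction using (sum)
open import Data.Bool.ListAction using (all)
open import Relation.Binary.PropositionalEquality using (_≡_)

-- A point of [0,1] given by a base-b digit expansion x = Σ_{j≥0} ξ_j b^{-(j+1)}
-- (digit ξ_j = toℕ (ξ j)).  floorPow b ξ k = ⌊ b^k x ⌋ computed from the first
-- k digits, i.e. b^k · [x]_{b,k}.
floorPow : (b : ℕ) → (ℕ → Fin b) → ℕ → ℕ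
floorPow b ξ zero    = 0
floorPow b ξ (suc k) = floorPow b ξ k * b + toℕ (ξ k)

gcdAll : {s : ℕ} → (Fin s → ℕ) → ℕ
gcdAll e = foldr gcd 0 (tabulate e)

-- Throughout, a sequence of points in [0,1]^s is described, for a base B, by
-- X : ℕ → Fin s → ℕ → ℕ with X n i m = ⌊ B^m x_{n,i} ⌋, so that the i-th coordinate
-- of the truncated point [x_n]_{B,m} equals X n i m / B^m.

-- The point with coordinates N_i / B^m lies in the elementary interval
-- Π_i [a_i B^{-d_i}, (a_i+1) B^{-d_i}), i.e. a_i B^m ≤ N_i B^{d_i} < (a_i+1) B^m.
inElemᵇ : {s : ℕ} (B m : ℕ) (d a N : Fin s → ℕ) → Bool
inElemᵇ {s} B m d a N =
  all (λ i → (a i * B ^ m ≤ᵇ N i * B ^ d i) ∧ (N i * B ^ d i <ᵇ suc (a i) * B ^ m))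
      (allFin s)

countIn : {s : ℕ} (B m k : ℕ) (X : ℕ → Fin s → ℕ → ℕ) (d a : Fin s → ℕ) → ℕ
countIn B m k X d a =
  length (filterᵇ (λ j → inElemᵇ B m d a (λ i → X (k * B ^ m + j) i m)) (upTo (B ^ m)))

-- The points [x_n]_{B,m}, k B^m ≤ n < (k+1) B^m, form a (u,m,e,s)-net in base B:
-- every elementary interval J (d_i ≥ 0, 0 ≤ a_i < B^{d_i}, e_i ∣ d_i) with
-- λ_s(J) = B^{-Σ d_i} ≥ B^{u-m} (i.e. Σ d_i + u ≤ m) contains exactly
-- B^m λ_s(J) = B^{m - Σ d_i} points.
IsNetBlock : {s : ℕ} (B u m k : ℕ) (e : Fin s → ℕ) (X : ℕ → Fin s → ℕ → ℕ) → Set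
IsNetBlock {s} B u m k e X =
  (d a : Fin s → ℕ) →
  (∀ i → a i < B ^ d i) →
  (∀ i → e i ∣ d i) →
  sum (tabulate d) + u ≤ m →
  countIn B m k X d a ≡ B ^ (m ∸ sum (tabulate d))

IsSequence : {s : ℕ} (B u : ℕ) (e : Fin s → ℕ) (X : ℕ → Fin s → ℕ → ℕ) → Set
IsSequence B u e X = (k m : ℕ) → u < m → IsNetBlock B u m k e X

module Submission where

-- Let H be the gcd h of e₁,…,e_s.  Reading digits in base b^H
-- in blocks of H base-b digits, the elementary interval in base b^H with
-- exponents dᵢ and offsets aᵢ is the same set as the elementary interval in base
-- b with exponents H·dᵢ and the same offsets, and a block of (b^H)^m points is a
-- block of b^(Hm) points.  Hence the count of points of the base-b^H block at
-- resolution m in such an interval equals the count of the base-b block at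
-- resolution Hm in the rescaled interval (countIn-rescale).  The rescaled
-- interval is admissible for the original (u,e,s)-sequence: eᵢ ∣ H·dᵢ because
-- H ∣ eᵢ and (eᵢ/H) ∣ dᵢ, and Σ H·dᵢ + u ≤ Hm because u ≤ H·⌈u/H⌉.  The
-- prescribed count b^(Hm − HΣdᵢ) is (b^H)^(m − Σdᵢ) (netBlock-coarsen).
-- Doing this for every block and resolution gives the statement for sequences
-- for any common divisor H of the eᵢ (sequence-coarsen); the theorem is the
-- case H = gcd, with ⌈u/H⌉ written as (u + H − 1)/H (ceil-div-bound).

open import Defs
open import Data.Nat using (ℕ; zero; suc; _+_; _*_; _/_; _%_; _∸_; _≤_; _<_; _^_; _≤ᵇ_; _<ᵇ_; NonZero; s≤s⁻¹)
open import Data.Nat.Properties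
open import Data.Nat.Divisibility using (_∣_; ∣-trans; *-monoʳ-∣)
open import Data.Nat.DivMod using (m≡m%n+[m/n]*n; m%n<n; m*[n/m]≡n)
open import Data.Nat.GCD using (gcd[m,n]∣m; gcd[m,n]∣n)
open import Data.Nat.ListAction using (sum)
open import Data.Bool using (Bool; T; _∧_)
open import Data.Bool.ListAction using (and)
open import Data.Fin using (Fin; zero; suc)
open import Data.List using (length; filterᵇ; upTo; tabulate; allFin)
open import Data.List.Properties using (map-cong; filter-≐)
open import Data.Product using (_,_)
open import Function using (_∘_)
open import Relation.Nullary.Decidable using (T?)
open import Relation.Binary.PropositionalEquality
  using (_≡_; _≗_; sym; trans; cong; cong₂; subst; module ≡-Reasoning)

gcdAll∣ : ∀ {s} (e : Fin s → ℕ) (i : Fin s) → gcdAll e ∣ e i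
gcdAll∣ e zero    = gcd[m,n]∣m (e zero) _
gcdAll∣ e (suc i) = ∣-trans (gcd[m,n]∣n (e zero) _) (gcdAll∣ (λ j → e (suc j)) i)

sum-scale : ∀ {s} (H : ℕ) (d : Fin s → ℕ) →
  sum (tabulate (λ i → H * d i)) ≡ H * sum (tabulate d)
sum-scale {zero}  H d = sym (*-zeroʳ H)
sum-scale {suc s} H d = begin
  H * d zero + sum (tabulate (λ i → H * d (suc i)))  ≡⟨ cong (H * d zero +_) (sum-scale H (λ i → d (suc i))) ⟩
  H * d zero + H * sum (tabulate (λ i → d (suc i)))  ≡⟨ *-distribˡ-+ H (d zero) _ ⟨
  H * (d zero + sum (tabulate (λ i → d (suc i))))    ∎
  where open ≡-Reasoning

-- (u + H − 1)/H is ⌈u/H⌉, so in particular H times it is at least u.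
ceil-div-bound : ∀ u h′ → u ≤ suc h′ * ((u + h′) / suc h′)
ceil-div-bound u h′ = +-cancelʳ-≤ h′ u (suc h′ * q) (begin
  u + h′                           ≡⟨ m≡m%n+[m/n]*n (u + h′) (suc h′) ⟩
  (u + h′) % suc h′ + q * suc h′   ≤⟨ +-monoˡ-≤ _ (s≤s⁻¹ (m%n<n (u + h′) (suc h′))) ⟩
  h′ + q * suc h′                  ≡⟨ +-comm h′ _ ⟩
  q * suc h′ + h′                  ≡⟨ cong (_+ h′) (*-comm q (suc h′)) ⟩
  suc h′ * q + h′                  ∎)
  where
  open ≤-Reasoning
  q : ℕ
  q = (u + h′) / suc h′

filterᵇ-cong : ∀ {A : Set} {p q : A → Bool} → p ≗ q → filterᵇ p ≗ filterᵇ q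
filterᵇ-cong {p = p} {q} p≗q = filter-≐ (T? ∘ p) (T? ∘ q)
  ((λ {x} → subst T (p≗q x)) , (λ {x} → subst T (sym (p≗q x))))

inElem-powers : ∀ {s} (B C m M : ℕ) (d D a N : Fin s → ℕ) →
  B ^ m ≡ C ^ M → (∀ i → B ^ d i ≡ C ^ D i) →
  inElemᵇ B m d a N ≡ inElemᵇ C M D a N
inElem-powers {s} B C m M d D a N m≡ d≡ = cong and (map-cong test≡ (allFin s))
  where
  test≡ : ∀ i → ((a i * B ^ m ≤ᵇ N i * B ^ d i) ∧ (N i * B ^ d i <ᵇ suc (a i) * B ^ m))
              ≡ ((a i * C ^ M ≤ᵇ N i * C ^ D i) ∧ (N i * C ^ D i <ᵇ suc (a i) * C ^ M))
  test≡ i = cong₂ _∧_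
    (cong₂ _≤ᵇ_ (cong (a i *_) m≡) (cong (N i *_) (d≡ i)))
    (cong₂ _<ᵇ_ (cong (N i *_) (d≡ i)) (cong (suc (a i) *_) m≡))

countIn-rescale : ∀ {s} (B H m k : ℕ) (X : ℕ → Fin s → ℕ → ℕ) (d a : Fin s → ℕ) →
  countIn (B ^ H) m k (λ n i m → X n i (H * m)) d a
    ≡ countIn B (H * m) k X (λ i → H * d i) a
countIn-rescale {s} B H m k X d a = begin
  length (filterᵇ coarse (upTo ((B ^ H) ^ m)))  ≡⟨ cong length (filterᵇ-cong coarse≗fine (upTo ((B ^ H) ^ m))) ⟩
  length (filterᵇ fine (upTo ((B ^ H) ^ m)))    ≡⟨ cong (λ P → length (filterᵇ fine (upTo P))) blocks≡ ⟩
  length (filterᵇ fine (upTo (B ^ (H * m))))    ∎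
  where
  open ≡-Reasoning
  blocks≡ : (B ^ H) ^ m ≡ B ^ (H * m)
  blocks≡ = ^-*-assoc B H m
  point : ℕ → ℕ → Fin s → ℕ
  point P j i = X (k * P + j) i (H * m)
  coarse fine : ℕ → Bool
  coarse j = inElemᵇ (B ^ H) m d a (point ((B ^ H) ^ m) j)
  fine j = inElemᵇ B (H * m) (λ i → H * d i) a (point (B ^ (H * m)) j)
  coarse≗fine : coarse ≗ fine
  coarse≗fine j = trans
    (cong (λ P → inElemᵇ (B ^ H) m d a (point P j)) blocks≡)
    (inElem-powers (B ^ H) B m (H * m) d (λ i → H * d i) a (point (B ^ (H * m)) j)
       blocks≡ (λ i → ^-*-assoc B H (d i)))

scaled-volume-bound : ∀ {s} (H u u′ m : ℕ) (d : Fin s → ℕ) →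
  u ≤ H * u′ → sum (tabulate d) + u′ ≤ m →
  sum (tabulate (λ i → H * d i)) + u ≤ H * m
scaled-volume-bound H u u′ m d u≤Hu′ Σd+u′≤m = begin
  sum (tabulate (λ i → H * d i)) + u  ≡⟨ cong (_+ u) (sum-scale H d) ⟩
  H * Σd + u                          ≤⟨ +-monoʳ-≤ (H * Σd) u≤Hu′ ⟩
  H * Σd + H * u′                     ≡⟨ *-distribˡ-+ H Σd u′ ⟨
  H * (Σd + u′)                       ≤⟨ *-monoʳ-≤ H Σd+u′≤m ⟩
  H * m                               ∎
  where
  open ≤-Reasoning
  Σd : ℕ
  Σd = sum (tabulate d)

netBlock-coarsen : ∀ {s} (B H u u′ m k : ℕ) .{{_ : NonZero H}}
  (e : Fin s → ℕ) (X : ℕ → Fin s → ℕ → ℕ) →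
  (∀ i → H ∣ e i) → u ≤ H * u′ →
  IsNetBlock B u (H * m) k e X →
  IsNetBlock (B ^ H) u′ m k (λ i → e i / H) (λ n i m → X n i (H * m))
netBlock-coarsen {s} B H u u′ m k e X H∣e u≤Hu′ net d a a< e/H∣d Σd+u′≤m = begin
  countIn (B ^ H) m k (λ n i m → X n i (H * m)) d a  ≡⟨ countIn-rescale B H m k X d a ⟩
  countIn B (H * m) k X Hd a                          ≡⟨ net Hd a a<′ e∣Hd (scaled-volume-bound H u u′ m d u≤Hu′ Σd+u′≤m) ⟩
  B ^ (H * m ∸ sum (tabulate Hd))                     ≡⟨ cong (λ t → B ^ (H * m ∸ t)) (sum-scale H d) ⟩
  B ^ (H * m ∸ H * Σd)                                ≡⟨ cong (B ^_) (*-distribˡ-∸ H m Σd) ⟨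
  B ^ (H * (m ∸ Σd))                                  ≡⟨ ^-*-assoc B H (m ∸ Σd) ⟨
  (B ^ H) ^ (m ∸ Σd)                                  ∎
  where
  open ≡-Reasoning
  Σd : ℕ
  Σd = sum (tabulate d)
  Hd : Fin s → ℕ
  Hd i = H * d i
  a<′ : ∀ i → a i < B ^ Hd i
  a<′ i = subst (a i <_) (^-*-assoc B H (d i)) (a< i)
  -- eᵢ = H·(eᵢ/H) divides H·dᵢ
  e∣Hd : ∀ i → e i ∣ Hd i
  e∣Hd i = subst (_∣ Hd i) (m*[n/m]≡n (H∣e i)) (*-monoʳ-∣ H (e/H∣d i))

sequence-coarsen : ∀ {s} (B H u u′ : ℕ) .{{_ : NonZero H}}
  (e : Fin s → ℕ) (X : ℕ → Fin s → ℕ → ℕ) →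
  (∀ i → H ∣ e i) → u ≤ H * u′ →
  IsSequence B u e X →
  IsSequence (B ^ H) u′ (λ i → e i / H) (λ n i m → X n i (H * m))
sequence-coarsen B H u u′ e X H∣e u≤Hu′ seq k m u′<m =
  netBlock-coarsen B H u u′ m k e X H∣e u≤Hu′
    (seq k (H * m) (≤-<-trans u≤Hu′ (*-monoʳ-< H u′<m)))

-- The theorem: take H = h = gcd(e₁,…,e_s) (written suc h′) and u′ = ⌈u/h⌉.
-- The hypotheses b ≥ 2, s ≥ 1 and eᵢ ≥ 1 only make the setting meaningful.
theorem5 : (b s u : ℕ) → 2 ≤ b → 1 ≤ s →
    (e : Fin s → ℕ) → (∀ i → 1 ≤ e i) →
    (h′ : ℕ) → suc h′ ≡ gcdAll e →
    (x : ℕ → Fin s → ℕ → Fin b) →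
    IsSequence b u e (λ n i m → floorPow b (x n i) m) →
    IsSequence (b ^ suc h′) ((u + h′) / suc h′) (λ i → e i / suc h′)
      (λ n i m → floorPow b (x n i) (suc h′ * m))
theorem5 b s u _ _ e _ h′ h≡gcd x =
  sequence-coarsen b (suc h′) u ((u + h′) / suc h′) e (λ n i m → floorPow b (x n i) m)
    h∣e (ceil-div-bound u h′)
  where
  h∣e : ∀ i → suc h′ ∣ e i
  h∣e i = subst (_∣ e i) (sym h≡gcd) (gcdAll∣ e i)
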